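{- Let $G$ be a bipartite graph with vertex bipartition $\{A,B\}$, where $|A|,|B|\ge 2$, let $t\in\mathbb N$, and let $f\colon A\cup B\to[0,t]$ be an $(A,B,t)$-uniformly ordered labeling of $G$. Then: (1) the $k$-shift $f_k$ is an $(A,B,t)$-uniformly ordered labeling of $G$ if and only if $k\in[0,t-\max f(B)]\cup[t+1-\min f(A),t]$ in the case $\min f(A)\ge 1$, or $k\in[0,t-\max f(B)]$ in the case $\min f(A)=0$; (2) $f_k$ is a $(B,A,t)$-uniformly ordered labeling of $G$ if and only if $k\in[t+1-\min f(B),\,t-\max f(A)]$.
   Context: $\mathbb N=\{0,1,2,\dots\}$; for integers $a\le b$, $[a,b]=\{x\in\mathbb N: a\le x\le b\}$ (empty if $a>b$). Graphs have no isolated vertices. For a graph $G=(V,E)$ with $|E|=m$ and $t\in\mathbb N$, a labeling is an injective map $f\colon V\to[0,t]$; it induces $\tilde f(\{u,v\})=|f(u)-f(v)|$. $f$ is a $\overline{\rho}$-labeling if (a) $t\ge 2m$, (b) $\tilde f$ is injective, (c) there is no $i\in\{1,\dots,m\}$ with both $i$ and $t+1-i$ in $\operatorname{Im}\tilde f$. For bipartite $G$ with vertex bipartition $\{A,B\}$, an $(A,B,t)$-uniformly ordered labeling is a $\overline{\rho}$-labeling $f\colon V\to[0,t]$ such that there is $\lambda\in\mathbb N$ with $f(a)\le\lambda$ for all $a\in A$ and $f(b)>\lambda$ for all $b\in B$; $(B,A,t)$-uniformly ordered is defined with $A,B$ exchanged. For $k\in[0,t]$, the $k$-shift of $f$ is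 $f_k(v)=f(v)+k$ reduced modulo $t+1$ into $[0,t]$. -}

module Defs where

open import Data.Nat using (ℕ; zero; suc; _+_; _∸_; _≤_; _<_; _≥_; ∣_-_∣; _%_)
open import Data.Fin using (Fin; toℕ)
open import Data.Bool using (Bool; true; false)
open import Data.List using (List; length; filter; allFin; cartesianProduct)
open import Data.Product using (Σ; ∃; ∃-syntax; _×_; _,_; proj₁; proj₂)
open import Data.Sum using (_⊎_)
open import Relation.Nullary using (¬_)
open import Relation.Binary.PropositionalEquality using (_≡_; _≢_)
open import Relation.Nullary.Decidable using (_×-dec_)
open import Data.Nat.Properties using (_<?_)
open import Data.Bool.Properties using () renaming (_≟_ to _≟ᵇ_)

record Graph (n : ℕ) : Set where
  field
    adj       : Fin n → Fin n → Bool
    symmetric : ∀ u v → adj u v ≡ adj v u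
    irreflex  : ∀ v → adj v v ≡ false
    noIsolated : ∀ v → ∃[ u ] (adj v u ≡ true)
open Graph public

edgeList : ∀ {n} → Graph n → List (Fin n × Fin n)
edgeList {n} G =
  filter (λ p → (toℕ (proj₁ p) <? toℕ (proj₂ p)) ×-dec (adj G (proj₁ p) (proj₂ p) ≟ᵇ true))
         (cartesianProduct (allFin n) (allFin n))

numEdges : ∀ {n} → Graph n → ℕ
numEdges G = length (edgeList G)

-- A bipartition {A,B} of the vertex set: inB v ≡ false means v ∈ A,
-- inB v ≡ true means v ∈ B; every edge joins A and B.
IsBipartition : ∀ {n} → Graph n → (Fin n → Bool) → Set
IsBipartition G inB = ∀ u v → adj G u v ≡ true → inB u ≢ inB v

InA InB : ∀ {n} → (Fin n → Bool) → Fin n → Set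
InA inB v = inB v ≡ false
InB inB v = inB v ≡ true

InImage : ∀ {n} → Graph n → (Fin n → ℕ) → ℕ → Set
InImage G f i = ∃[ u ] ∃[ v ] (adj G u v ≡ true × ∣ f u - f v ∣ ≡ i)

IsLabeling : ∀ {n} → (Fin n → ℕ) → ℕ → Set
IsLabeling f t = (∀ v → f v ≤ t) × (∀ u v → f u ≡ f v → u ≡ v)

IsRhoBarLabeling : ∀ {n} → Graph n → (Fin n → ℕ) → ℕ → Set
IsRhoBarLabeling G f t =
  IsLabeling f t
  × (2 * numEdges G ≤ t)
  × (∀ u v u' v' → adj G u v ≡ true → adj G u' v' ≡ true →
       ∣ f u - f v ∣ ≡ ∣ f u' - f v' ∣ →
       (u ≡ u' × v ≡ v') ⊎ (u ≡ v' × v ≡ u'))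
  × (¬ (∃[ i ] (1 ≤ i × i ≤ numEdges G × InImage G f i × InImage G f (suc t ∸ i))))
  where open import Data.Nat using (_*_)

IsUniformlyOrdered : ∀ {n} → Graph n → (X Y : Fin n → Set) → (Fin n → ℕ) → ℕ → Set
IsUniformlyOrdered G X Y f t =
  IsRhoBarLabeling G f t
  × ∃[ λ' ] ((∀ a → X a → f a ≤ λ') × (∀ b → Y b → λ' < f b))

shift : ∀ {n} → (Fin n → ℕ) → ℕ → ℕ → (Fin n → ℕ)
shift f t k v = (f v + k) % suc t

IsMinOn IsMaxOn : ∀ {n} → (Fin n → Set) → (Fin n → ℕ) → ℕ → Set
IsMinOn P f M = (∃[ v ] (P v × f v ≡ M)) × (∀ v → P v → M ≤ f v)
IsMaxOn P f M = (∃[ v ] (P v × f v ≡ M)) × (∀ v → P v → f v ≤ M)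

AtLeastTwo : ∀ {n} → (Fin n → Set) → Set
AtLeastTwo P = ∃[ u ] ∃[ v ] (P u × P v × u ≢ v)

_∈[_,_] : ℕ → ℕ → ℕ → Set
k ∈[ a , b ] = a ≤ k × k ≤ b

{-# OPTIONS --safe #-}
-- Adding k modulo t+1 sends a label x ≤ t to x + k if x + k ≤ t and to
-- x + k − (t+1) < k otherwise, so the labels that wrap are the largest ones and
-- land below all the others.  If every vertex falls on the same side, f_k is a
-- translate of f and inherits its edge labels and its order.  If exactly the
-- vertices of B wrap, each edge label d becomes t+1−d, which permutes the
-- forbidden pairs {i, t+1−i}, and B now lies below A.  Otherwise either max f(B)
-- wraps while min f(A) does not, or max f(A) and min f(B) land on the same side,
-- where their order is kept; either way the required order fails.
module Submission where

open import Defs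
open import Data.Nat
open import Data.Nat.Properties
open import Data.Nat.DivMod using (_%_; m%n<n; m≤n⇒m%n≡m; m≤n⇒[n∸m]%m≡n%m)
open import Data.Fin using (Fin)
open import Data.Bool using (Bool; true; false)
open import Data.Product using (_×_; _,_; ∃-syntax; proj₁; proj₂)
open import Data.Sum using (_⊎_; inj₁; inj₂; fromInj₁)
open import Data.Sum.Function.Propositional using (_⊎-⇔_)
open import Data.Empty using (⊥-elim)
open import Function using (_∘_)
open import Function.Bundles using (_⇔_; mk⇔; Equivalence)
open import Function.Construct.Composition using (_⇔-∘_)
open import Relation.Nullary using (¬_; yes; no; contradiction)
open import Relation.Binary using (tri<; tri≈; tri>)
open import Relation.Binary.PropositionalEquality

r+1+t≡x+k⇒r<k : ∀ {r x t k} → x ≤ t → r + suc t ≡ x + k → r < k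
r+1+t≡x+k⇒r<k {r} {x} {t} {k} x≤t eq = +-cancelʳ-< (suc t) r k (begin-strict
  r + suc t  ≡⟨ eq ⟩
  x + k      ≤⟨ +-monoˡ-≤ k x≤t ⟩
  t + k      <⟨ n<1+n (t + k) ⟩
  suc t + k  ≡⟨ +-comm (suc t) k ⟩
  k + suc t  ∎)
  where open ≤-Reasoning

module Rotation (t k : ℕ) (k≤t : k ≤ t) where

  rot : ℕ → ℕ
  rot x = (x + k) % suc t

  rot≤t : ∀ x → rot x ≤ t
  rot≤t x = s≤s⁻¹ (m%n<n (x + k) (suc t))

  rot-unwrapped : ∀ {x} → x + k ≤ t → rot x ≡ x + k
  rot-unwrapped = m≤n⇒m%n≡m

  rot-wrapped : ∀ {x} → x ≤ t → t < x + k → rot x + suc t ≡ x + k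
  rot-wrapped {x} x≤t t<x+k = begin
    (x + k) % suc t + suc t          ≡⟨ cong (_+ suc t) (m≤n⇒[n∸m]%m≡n%m t<x+k) ⟨
    (x + k ∸ suc t) % suc t + suc t  ≡⟨ cong (_+ suc t) (m≤n⇒m%n≡m excess≤t) ⟩
    x + k ∸ suc t + suc t            ≡⟨ m∸n+n≡m t<x+k ⟩
    x + k                            ∎
    where
    open ≡-Reasoning
    excess≤t : x + k ∸ suc t ≤ t
    excess≤t = m≤n+o⇒m∸n≤o (x + k) (suc t) (≤-trans (+-mono-≤ x≤t k≤t) (n≤1+n (t + t)))

  rot-wrapped<k : ∀ {x} → x ≤ t → t < x + k → rot x < k
  rot-wrapped<k x≤t t<x+k = r+1+t≡x+k⇒r<k x≤t (rot-wrapped x≤t t<x+k)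

  rot-wrapped<unwrapped : ∀ {x y} → y ≤ t → t < y + k → x + k ≤ t → rot y < rot x
  rot-wrapped<unwrapped {x} y≤t t<y+k x+k≤t =
    <-≤-trans (rot-wrapped<k y≤t t<y+k) (subst (k ≤_) (sym (rot-unwrapped x+k≤t)) (m≤n+m k x))

  rot-mono-< : ∀ {x y} → x < y → y ≤ t → y + k ≤ t ⊎ t < x + k → rot x < rot y
  rot-mono-< x<y y≤t (inj₁ y+k≤t) =
    subst₂ _<_ (sym (rot-unwrapped (≤-trans (+-monoˡ-≤ k (<⇒≤ x<y)) y+k≤t)))
               (sym (rot-unwrapped y+k≤t)) (+-monoˡ-< k x<y)
  rot-mono-< x<y y≤t (inj₂ t<x+k) = +-cancelʳ-< (suc t) _ _
    (subst₂ _<_ (sym (rot-wrapped (≤-trans (<⇒≤ x<y) y≤t) t<x+k))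
                (sym (rot-wrapped y≤t (<-trans t<x+k (+-monoˡ-< k x<y)))) (+-monoˡ-< k x<y))

  rot-<⇒≢ : ∀ {x y} → x < y → y ≤ t → rot x ≢ rot y
  rot-<⇒≢ {x} {y} x<y y≤t with y + k ≤? t | x + k ≤? t
  ... | yes y+k≤t | _         = <⇒≢ (rot-mono-< x<y y≤t (inj₁ y+k≤t))
  ... | no  y+k≰t | no  x+k≰t = <⇒≢ (rot-mono-< x<y y≤t (inj₂ (≰⇒> x+k≰t)))
  ... | no  y+k≰t | yes x+k≤t = >⇒≢ (rot-wrapped<unwrapped y≤t (≰⇒> y+k≰t) x+k≤t)

  rot-injective : ∀ {x y} → x ≤ t → y ≤ t → rot x ≡ rot y → x ≡ y
  rot-injective {x} {y} x≤t y≤t eq with <-cmp x y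
  ... | tri< x<y _ _ = contradiction eq (rot-<⇒≢ x<y y≤t)
  ... | tri≈ _ x≡y _ = x≡y
  ... | tri> _ _ y<x = contradiction (sym eq) (rot-<⇒≢ y<x x≤t)

shift-isLabeling : ∀ {n} {f : Fin n → ℕ} {t k} → k ≤ t → IsLabeling f t → IsLabeling (shift f t k) t
shift-isLabeling {f = f} {t} {k} k≤t (bounded , injective) =
  (λ v → rot≤t (f v)) , λ u v eq → injective u v (rot-injective (bounded u) (bounded v) eq)
  where open Rotation t k k≤t

∣-∣-translate : ∀ {x y x′ y′} c k → x′ + c ≡ x + k → y′ + c ≡ y + k → ∣ x′ - y′ ∣ ≡ ∣ x - y ∣
∣-∣-translate {x} {y} {x′} {y′} c k ex ey = begin
  ∣ x′ - y′ ∣          ≡⟨ ∣m+n-m+o∣≡∣n-o∣ c x′ y′ ⟨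
  ∣ c + x′ - c + y′ ∣  ≡⟨ cong₂ ∣_-_∣ (+-comm c x′) (+-comm c y′) ⟩
  ∣ x′ + c - y′ + c ∣  ≡⟨ cong₂ ∣_-_∣ ex ey ⟩
  ∣ x + k - y + k ∣    ≡⟨ cong₂ ∣_-_∣ (+-comm x k) (+-comm y k) ⟩
  ∣ k + x - k + y ∣    ≡⟨ ∣m+n-m+o∣≡∣n-o∣ k x y ⟩
  ∣ x - y ∣            ∎
  where open ≡-Reasoning

∣-∣+≡ : ∀ {a b d s} → a + d ≡ b + s → d ≤ s → ∣ a - b ∣ + d ≡ s
∣-∣+≡ {a} {b} {d} eq d≤s with e , refl ← m≤n⇒∃[o]m+o≡n d≤s = begin
  ∣ a - b ∣ + d      ≡⟨ cong (λ z → ∣ z - b ∣ + d) a≡b+e ⟩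
  ∣ b + e - b ∣ + d  ≡⟨ cong (_+ d) (trans (∣-∣-comm (b + e) b) (∣m-m+n∣≡n b e)) ⟩
  e + d              ≡⟨ +-comm e d ⟩
  d + e              ∎
  where
  open ≡-Reasoning
  a≡b+e : a ≡ b + e
  a≡b+e = +-cancelʳ-≡ d a (b + e)
    (trans eq (trans (cong (b +_) (+-comm d e)) (sym (+-assoc b e d))))

∣-∣-complement : ∀ {x y x′ y′} t k → x ≤ y → y ≤ t → x′ ≡ x + k → y′ + suc t ≡ y + k →
                 ∣ x′ - y′ ∣ + ∣ x - y ∣ ≡ suc t
∣-∣-complement {x} {y} {x′} {y′} t k x≤y y≤t refl ey =
  subst (λ d → ∣ x′ - y′ ∣ + d ≡ suc t) (sym (m≤n⇒∣m-n∣≡n∸m x≤y))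
    (∣-∣+≡ (trans gap (sym ey)) (m≤n⇒m≤1+n (≤-trans (m∸n≤m y x) y≤t)))
  where
  open ≡-Reasoning
  gap : x + k + (y ∸ x) ≡ y + k
  gap = begin
    x + k + (y ∸ x)  ≡⟨ +-assoc x k (y ∸ x) ⟩
    x + (k + (y ∸ x)) ≡⟨ cong (x +_) (+-comm k (y ∸ x)) ⟩
    x + ((y ∸ x) + k) ≡⟨ +-assoc x (y ∸ x) k ⟨
    x + (y ∸ x) + k  ≡⟨ cong (_+ k) (m+[n∸m]≡n x≤y) ⟩
    y + k            ∎

EdgeLabelsInjective : ∀ {n} → Graph n → (Fin n → ℕ) → Set
EdgeLabelsInjective G h = ∀ u v u′ v′ → adj G u v ≡ true → adj G u′ v′ ≡ true →
  ∣ h u - h v ∣ ≡ ∣ h u′ - h v′ ∣ → (u ≡ u′ × v ≡ v′) ⊎ (u ≡ v′ × v ≡ u′)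

ForbiddenPair : ∀ {n} → Graph n → ℕ → (Fin n → ℕ) → Set
ForbiddenPair G t h = ∃[ i ] (1 ≤ i × i ≤ numEdges G × InImage G h i × InImage G h (suc t ∸ i))

module _ {n} (G : Graph n) {f g : Fin n → ℕ} {t : ℕ} where

  isRhoBar-resp-edgeLabels : IsLabeling g t →
    (∀ u v → adj G u v ≡ true → ∣ g u - g v ∣ ≡ ∣ f u - f v ∣) →
    IsRhoBarLabeling G f t → IsRhoBarLabeling G g t
  isRhoBar-resp-edgeLabels lab-g same (_ , 2m≤t , injective , noPair) =
    lab-g , 2m≤t , injective′ , noPair ∘ transport
    where
    injective′ : EdgeLabelsInjective G g
    injective′ u v u′ v′ e e′ eq =
      injective u v u′ v′ e e′ (trans (sym (same u v e)) (trans eq (same u′ v′ e′)))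
    image : ∀ {i} → InImage G g i → InImage G f i
    image (u , v , e , eq) = u , v , e , trans (sym (same u v e)) eq
    transport : ForbiddenPair G t g → ForbiddenPair G t f
    transport (i , 1≤i , i≤m , im , im′) = i , 1≤i , i≤m , image im , image im′

  isRhoBar-complement : IsLabeling g t →
    (∀ u v → adj G u v ≡ true → ∣ g u - g v ∣ + ∣ f u - f v ∣ ≡ suc t) →
    IsRhoBarLabeling G f t → IsRhoBarLabeling G g t
  isRhoBar-complement lab-g compl (_ , 2m≤t , injective , noPair) =
    lab-g , 2m≤t , injective′ , noPair ∘ transport
    where
    injective′ : EdgeLabelsInjective G g
    injective′ u v u′ v′ e e′ eq = injective u v u′ v′ e e′
      (+-cancelˡ-≡ ∣ g u - g v ∣ _ _ (trans (compl u v e)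
        (trans (sym (compl u′ v′ e′)) (cong (_+ ∣ f u′ - f v′ ∣) (sym eq)))))
    image : ∀ {i j} → i + j ≡ suc t → InImage G g i → InImage G f j
    image i+j≡1+t (u , v , e , refl) =
      u , v , e , +-cancelˡ-≡ ∣ g u - g v ∣ _ _ (trans (compl u v e) (sym i+j≡1+t))
    ≤1+t : ∀ {i} → InImage G g i → i ≤ suc t
    ≤1+t (u , v , e , refl) = m+n≤o⇒m≤o _ (≤-reflexive (compl u v e))
    transport : ForbiddenPair G t g → ForbiddenPair G t f
    transport (i , 1≤i , i≤m , im , im′) =
      i , 1≤i , i≤m , image (m∸n+n≡m (≤1+t im)) im′ , image (m+[n∸m]≡n (≤1+t im)) im

module _ {n} (G : Graph n) (X Y : Fin n → Set) {t : ℕ} where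

  uniformlyOrdered⇒< : ∀ {f} → IsUniformlyOrdered G X Y f t → ∀ {x y} → X x → Y y → f x < f y
  uniformlyOrdered⇒< (_ , _ , below , above) Xx Yy = ≤-<-trans (below _ Xx) (above _ Yy)

  -- X x₀ gives c ≤ λ′ + k, so the new threshold λ′ + k ∸ c is not truncated.
  isUniformlyOrdered-translate : ∀ {f g} c k {x₀} → X x₀ → IsLabeling g t →
    (∀ v → g v + c ≡ f v + k) →
    IsUniformlyOrdered G X Y f t → IsUniformlyOrdered G X Y g t
  isUniformlyOrdered-translate {f} {g} c k {x₀} Xx₀ lab-g shifted (ρ , λ′ , below , above) =
    isRhoBar-resp-edgeLabels G lab-g (λ u v _ → ∣-∣-translate c k (shifted u) (shifted v)) ρ ,
    λ′ + k ∸ c , (λ a Xa → m+n≤o⇒m≤o∸n (g a) (shifted≤ a Xa)) , above′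
    where
    shifted≤ : ∀ a → X a → g a + c ≤ λ′ + k
    shifted≤ a Xa = subst (_≤ λ′ + k) (sym (shifted a)) (+-monoˡ-≤ k (below a Xa))
    above′ : ∀ b → Y b → λ′ + k ∸ c < g b
    above′ b Yb = +-cancelʳ-< c _ _ (begin-strict
      λ′ + k ∸ c + c  ≡⟨ m∸n+n≡m (m+n≤o⇒n≤o (g x₀) (shifted≤ x₀ Xx₀)) ⟩
      λ′ + k          <⟨ +-monoˡ-< k (above b Yb) ⟩
      f b + k         ≡⟨ shifted b ⟨
      g b + c         ∎)
      where open ≤-Reasoning

separatedAt : ∀ {n} {X Y : Fin n → Set} {h : Fin n → ℕ} k {y₀} → Y y₀ →
  (∀ y → Y y → h y < k) → (∀ x → X x → k ≤ h x) →
  ∃[ λ′ ] ((∀ y → Y y → h y ≤ λ′) × (∀ x → X x → λ′ < h x))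
separatedAt zero    Yy₀ below _     = contradiction (below _ Yy₀) λ ()
separatedAt (suc k) _   below above = k , (λ y Yy → s≤s⁻¹ (below y Yy)) , above

isUniformlyOrdered-swap : ∀ {n} (G : Graph n) (inB : Fin n → Bool) {f g : Fin n → ℕ} {t} k {b₀} →
  IsBipartition G inB → InB inB b₀ → IsLabeling g t →
  (∀ a → InA inB a → g a ≡ f a + k) → (∀ b → InB inB b → g b + suc t ≡ f b + k) →
  IsUniformlyOrdered G (InA inB) (InB inB) f t → IsUniformlyOrdered G (InB inB) (InA inB) g t
isUniformlyOrdered-swap G inB {f} {g} {t} k bipartite Bb₀ lab-g kept wrapped uo@(ρ , _) =
  isRhoBar-complement G lab-g complement ρ ,
  separatedAt k Bb₀ below-k (λ a Aa → subst (k ≤_) (sym (kept a Aa)) (m≤n+m k (f a)))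
  where
  bounded : ∀ v → f v ≤ t
  bounded = proj₁ (proj₁ ρ)
  below-k : ∀ b → InB inB b → g b < k
  below-k b Bb = r+1+t≡x+k⇒r<k (bounded b) (wrapped b Bb)
  complementAB : ∀ a b → InA inB a → InB inB b → ∣ g a - g b ∣ + ∣ f a - f b ∣ ≡ suc t
  complementAB a b Aa Bb =
    ∣-∣-complement t k (<⇒≤ (uniformlyOrdered⇒< G (InA inB) (InB inB) uo Aa Bb))
                       (bounded b) (kept a Aa) (wrapped b Bb)
  complement : ∀ u v → adj G u v ≡ true → ∣ g u - g v ∣ + ∣ f u - f v ∣ ≡ suc t
  complement u v e with inB u in eu | inB v in ev
  ... | false | false = ⊥-elim (bipartite u v e (trans eu (sym ev)))
  ... | true  | true  = ⊥-elim (bipartite u v e (trans eu (sym ev)))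
  ... | false | true  = complementAB u v eu ev
  ... | true  | false = subst₂ (λ p q → p + q ≡ suc t) (∣-∣-comm (g v) (g u)) (∣-∣-comm (f v) (f u))
                          (complementAB v u ev eu)

+≤⇔∈[0,∸] : ∀ {m t k} → m ≤ t → m + k ≤ t ⇔ k ∈[ 0 , t ∸ m ]
+≤⇔∈[0,∸] {m} {t} {k} m≤t = mk⇔
  (λ m+k≤t → z≤n , m+n≤o⇒m≤o∸n k (subst (_≤ t) (+-comm m k) m+k≤t))
  (λ (_ , k≤t∸m) → subst (_≤ t) (+-comm k m) (m≤o∸n⇒m+n≤o k m≤t k≤t∸m))

<+⇔1+∸≤ : ∀ {m t k} → t < m + k ⇔ suc t ∸ m ≤ k
<+⇔1+∸≤ {m} {t} = mk⇔ (m≤n+o⇒m∸n≤o (suc t) m) (λ le → ≤-trans (m≤n+m∸n (suc t) m) (+-monoʳ-≤ m le))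

<+⇔∈[1+∸,] : ∀ {m t k} → k ≤ t → t < m + k ⇔ k ∈[ suc t ∸ m , t ]
<+⇔∈[1+∸,] {m} k≤t = mk⇔
  (λ lt → Equivalence.to (<+⇔1+∸≤ {m}) lt , k≤t)
  (Equivalence.from (<+⇔1+∸≤ {m}) ∘ proj₁)

<+×+≤⇔∈[1+∸,∸] : ∀ {m m′ t k} → m′ ≤ t → (t < m + k × m′ + k ≤ t) ⇔ k ∈[ suc t ∸ m , t ∸ m′ ]
<+×+≤⇔∈[1+∸,∸] {m} m′≤t = mk⇔
  (λ (lt , le) → Equivalence.to (<+⇔1+∸≤ {m}) lt , proj₂ (Equivalence.to (+≤⇔∈[0,∸] m′≤t) le))
  (λ (lo , hi) → Equivalence.from (<+⇔1+∸≤ {m}) lo , Equivalence.from (+≤⇔∈[0,∸] m′≤t) (z≤n , hi))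

⇔⊎-dropʳ : {P A B : Set} → P ⇔ (A ⊎ B) → ¬ B → P ⇔ A
⇔⊎-dropʳ P⇔A⊎B ¬B = mk⇔
  (fromInj₁ (⊥-elim ∘ ¬B) ∘ Equivalence.to P⇔A⊎B)
  (Equivalence.from P⇔A⊎B ∘ inj₁)

module _ {n} (G : Graph n) (inB : Fin n → Bool) {t k : ℕ} {f : Fin n → ℕ}
         (k≤t : k ≤ t) (uo : IsUniformlyOrdered G (InA inB) (InB inB) f t) where

  open Rotation t k k≤t

  private
    bounded : ∀ v → f v ≤ t
    bounded = proj₁ (proj₁ (proj₁ uo))

    shift-labeling : IsLabeling (shift f t k) t
    shift-labeling = shift-isLabeling k≤t (proj₁ (proj₁ uo))

    A<B : ∀ {a b} → InA inB a → InB inB b → f a < f b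
    A<B = uniformlyOrdered⇒< G (InA inB) (InB inB) uo

  minA≤ : ∀ {minA} → IsMinOn (InA inB) f minA → ∀ v → minA ≤ f v
  minA≤ ((a₀ , Aa₀ , refl) , minimal) v with inB v in ev
  ... | false = minimal v ev
  ... | true  = <⇒≤ (A<B Aa₀ ev)

  ≤maxB : ∀ {maxB} → IsMaxOn (InB inB) f maxB → ∀ v → f v ≤ maxB
  ≤maxB ((b₀ , Bb₀ , refl) , maximal) v with inB v in ev
  ... | false = <⇒≤ (A<B ev Bb₀)
  ... | true  = maximal v ev

  shift-uniformlyOrdered⇔ : ∀ {minA maxB} → IsMinOn (InA inB) f minA → IsMaxOn (InB inB) f maxB →
    IsUniformlyOrdered G (InA inB) (InB inB) (shift f t k) t
      ⇔ (k ∈[ 0 , t ∸ maxB ] ⊎ k ∈[ suc t ∸ minA , t ])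
  shift-uniformlyOrdered⇔ isMinA@((a₀ , Aa₀ , refl) , _) isMaxB@((b₀ , Bb₀ , refl) , _) =
    (+≤⇔∈[0,∸] (bounded b₀) ⊎-⇔ <+⇔∈[1+∸,] k≤t) ⇔-∘ mk⇔ onlyIf if
    where
    onlyIf : IsUniformlyOrdered G (InA inB) (InB inB) (shift f t k) t → f b₀ + k ≤ t ⊎ t < f a₀ + k
    onlyIf uo′ with f b₀ + k ≤? t | f a₀ + k ≤? t
    ... | yes b₀+k≤t | _          = inj₁ b₀+k≤t
    ... | no  _      | no a₀+k≰t  = inj₂ (≰⇒> a₀+k≰t)
    ... | no  b₀+k≰t | yes a₀+k≤t =
      contradiction (uniformlyOrdered⇒< G (InA inB) (InB inB) uo′ Aa₀ Bb₀)
                    (<⇒≯ (rot-wrapped<unwrapped (bounded b₀) (≰⇒> b₀+k≰t) a₀+k≤t))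
    if : f b₀ + k ≤ t ⊎ t < f a₀ + k → IsUniformlyOrdered G (InA inB) (InB inB) (shift f t k) t
    if (inj₁ b₀+k≤t) = isUniformlyOrdered-translate G (InA inB) (InB inB) 0 k Aa₀ shift-labeling
      (λ v → trans (+-identityʳ _) (rot-unwrapped (≤-trans (+-monoˡ-≤ k (≤maxB isMaxB v)) b₀+k≤t))) uo
    if (inj₂ t<a₀+k) = isUniformlyOrdered-translate G (InA inB) (InB inB) (suc t) k Aa₀ shift-labeling
      (λ v → rot-wrapped (bounded v) (<-≤-trans t<a₀+k (+-monoˡ-≤ k (minA≤ isMinA v)))) uo

  shift-swapped⇔ : ∀ {maxA minB} → IsBipartition G inB →
    IsMaxOn (InA inB) f maxA → IsMinOn (InB inB) f minB →
    IsUniformlyOrdered G (InB inB) (InA inB) (shift f t k) t ⇔ k ∈[ suc t ∸ minB , t ∸ maxA ]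
  shift-swapped⇔ bipartite ((a₀ , Aa₀ , refl) , maximal) ((b₀ , Bb₀ , refl) , minimal) =
    <+×+≤⇔∈[1+∸,∸] (bounded a₀) ⇔-∘ mk⇔ onlyIf if
    where
    a₀<b₀ : f a₀ < f b₀
    a₀<b₀ = A<B Aa₀ Bb₀
    onlyIf : IsUniformlyOrdered G (InB inB) (InA inB) (shift f t k) t → t < f b₀ + k × f a₀ + k ≤ t
    onlyIf uo′ = t<b₀+k , a₀+k≤t
      where
      b₀<a₀ : rot (f b₀) < rot (f a₀)
      b₀<a₀ = uniformlyOrdered⇒< G (InB inB) (InA inB) uo′ Bb₀ Aa₀
      t<b₀+k : t < f b₀ + k
      t<b₀+k with f b₀ + k ≤? t
      ... | yes b₀+k≤t = contradiction (rot-mono-< a₀<b₀ (bounded b₀) (inj₁ b₀+k≤t)) (<⇒≯ b₀<a₀)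
      ... | no  b₀+k≰t = ≰⇒> b₀+k≰t
      a₀+k≤t : f a₀ + k ≤ t
      a₀+k≤t with f a₀ + k ≤? t
      ... | yes a₀+k≤t = a₀+k≤t
      ... | no  a₀+k≰t = contradiction (rot-mono-< a₀<b₀ (bounded b₀) (inj₂ (≰⇒> a₀+k≰t))) (<⇒≯ b₀<a₀)
    if : t < f b₀ + k × f a₀ + k ≤ t → IsUniformlyOrdered G (InB inB) (InA inB) (shift f t k) t
    if (t<b₀+k , a₀+k≤t) = isUniformlyOrdered-swap G inB k bipartite Bb₀ shift-labeling
      (λ a Aa → rot-unwrapped (≤-trans (+-monoˡ-≤ k (maximal a Aa)) a₀+k≤t))
      (λ b Bb → rot-wrapped (bounded b) (<-≤-trans t<b₀+k (+-monoˡ-≤ k (minimal b Bb)))) uo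

lemma2 : ∀ {n} (G : Graph n) (inB : Fin n → Bool) (t : ℕ) (f : Fin n → ℕ)
         → IsBipartition G inB
         → AtLeastTwo (InA inB) → AtLeastTwo (InB inB)
         → IsUniformlyOrdered G (InA inB) (InB inB) f t
         → (minA maxA minB maxB : ℕ)
         → IsMinOn (InA inB) f minA → IsMaxOn (InA inB) f maxA
         → IsMinOn (InB inB) f minB → IsMaxOn (InB inB) f maxB
         → ∀ k → k ≤ t
         → ((minA ≥ 1 →
              (IsUniformlyOrdered G (InA inB) (InB inB) (shift f t k) t
                ⇔ (k ∈[ 0 , t ∸ maxB ] ⊎ k ∈[ suc t ∸ minA , t ])))
            × (minA ≡ 0 →
              (IsUniformlyOrdered G (InA inB) (InB inB) (shift f t k) t
                ⇔ k ∈[ 0 , t ∸ maxB ])))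
           × (IsUniformlyOrdered G (InB inB) (InA inB) (shift f t k) t
                ⇔ k ∈[ suc t ∸ minB , t ∸ maxA ])
lemma2 G inB t f bipartite _ _ uo minA _ _ maxB isMinA isMaxA isMinB isMaxB k k≤t =
  ((λ _ → sameOrientation) , λ minA≡0 → ⇔⊎-dropʳ sameOrientation (emptyInterval minA≡0)) ,
  shift-swapped⇔ G inB k≤t uo bipartite isMaxA isMinB
  where
  sameOrientation : IsUniformlyOrdered G (InA inB) (InB inB) (shift f t k) t
                      ⇔ (k ∈[ 0 , t ∸ maxB ] ⊎ k ∈[ suc t ∸ minA , t ])
  sameOrientation = shift-uniformlyOrdered⇔ G inB k≤t uo isMinA isMaxB
  emptyInterval : minA ≡ 0 → ¬ k ∈[ suc t ∸ minA , t ]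
  emptyInterval refl (t<k , _) = <⇒≱ t<k k≤t
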